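{- Fix $m\ge0$, and let $(a_i)$ and $(b_i)$ be sequences in a field $F$ of characteristic zero, with binomial array entries $a_{k,n}$ and $b_{k,n}$ respectively. For all integers $r,s,t$, $$\sum_{i=0}^m a_{i,r+i}\,b_{m-i,s-i}=\sum_{i=0}^m a_{i,r+i+t}\,b_{m-i,s-i-t}.$$
   Context: For a sequence $(a_i)_{i\ge0}$ with generating function $p(x)=\sum_ia_ix^i$, the binomial array has entries $a_{k,n}$ ($k\ge0$ row, $n\in\mathbb{Z}$ column) equal to the coefficient of $x^k$ in $(1+x)^np(x)$, with $(1+x)^n$ the inverse power series when $n<0$. Equivalently $a_{k,0}=a_k$, $a_{0,n}=a_0$, $a_{k,n+1}=a_{k-1,n}+a_{k,n}$. -}

module Defs where

open import Level using (_⊔_)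
open import Data.Nat using (ℕ; zero; suc; _∸_)
open import Data.Integer using (ℤ; +_; -[1+_])
open import Data.Product using (∃)
open import Relation.Nullary using (¬_)
open import Relation.Binary.PropositionalEquality using (_≡_)
open import Algebra.Bundles using (CommutativeRing)

module _ {c ℓ} (R : CommutativeRing c ℓ) where
  open CommutativeRing R

  record IsField : Set (c ⊔ ℓ) where
    field
      nontrivial : ¬ (1# ≈ 0#)
      inverse    : ∀ x → ¬ (x ≈ 0#) → ∃ λ y → x * y ≈ 1#

  natCast : ℕ → Carrier
  natCast zero    = 0#
  natCast (suc n) = 1# + natCast n

  CharZero : Set ℓ
  CharZero = ∀ n → natCast n ≈ 0# → n ≡ 0

  -- Binomial array a_{k,n}: a_{k,0} = a_k, a_{0,n} = a_0,
  -- a_{k,n+1} = a_{k-1,n} + a_{k,n}  (for all integers n).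
  -- arrPos k n = a_{k,n},  arrNeg k n = a_{k,-n}.
  arrPos : (ℕ → Carrier) → ℕ → ℕ → Carrier
  arrPos a k       zero    = a k
  arrPos a zero    (suc n) = a 0
  arrPos a (suc k) (suc n) = arrPos a k n + arrPos a (suc k) n

  arrNeg : (ℕ → Carrier) → ℕ → ℕ → Carrier
  arrNeg a k       zero    = a k
  arrNeg a zero    (suc n) = a 0
  arrNeg a (suc k) (suc n) = arrNeg a (suc k) n - arrNeg a k (suc n)

  binArr : (ℕ → Carrier) → ℕ → ℤ → Carrier
  binArr a k (+ n)      = arrPos a k n
  binArr a k -[1+ n ]   = arrNeg a k (suc n)

  sumTo : ℕ → (ℕ → Carrier) → Carrier
  sumTo zero    f = f 0
  sumTo (suc m) f = sumTo m f + f (suc m)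

-- Write D_m(r, s) = Σ_{i ≤ m} a_{i,r+i} b_{m-i,s-i}; the claim is that D_m(r, s)
-- depends only on r + s.  Splitting every factor with Pascal's rule gives
--   D_{m+1}(r+1, s) = D_{m+1}(r, s) + D_m(r+1, s-1)   (Pascal on the a-factors),
--   D_{m+1}(r, s+1) = D_{m+1}(r, s) + D_m(r, s)       (Pascal on the b-factors),
-- using that row 0 of a binomial array is constant.  Together with induction on m
-- these give D_m(r+1, s-1) = D_m(r, s), and iterating over t ∈ ℤ proves the claim.
module Submission where

open import Defs
open import Data.Nat using (ℕ; _∸_; zero; suc; _≤_; z≤n)
open import Data.Nat.Properties using (m≤n⇒m≤1+n; ≤-refl; +-∸-assoc; n∸n≡0)
open import Data.Integer using (ℤ; +_; -[1+_]; _+_; _-_)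
import Data.Integer.Properties as ℤ
open import Data.Integer.Tactic.RingSolver using (solve-∀)
open import Algebra.Bundles using (CommutativeRing)
open import Relation.Binary.PropositionalEquality as ≡ using (_≡_; cong; cong₂)
import Relation.Binary.Reasoning.Setoid as SetoidReasoning

module _ {c ℓ} (F : CommutativeRing c ℓ) where
  open CommutativeRing F renaming (_+_ to _⊕_; _-_ to _⊖_)
  open SetoidReasoning setoid
  open import Algebra.Properties.AbelianGroup +-abelianGroup using (//-rightDividesˡ)
  open import Algebra.Properties.CommutativeSemigroup +-commutativeSemigroup
    using (interchange; xy∙z≈xz∙y)

  binArr-zero-row : ∀ a (n : ℤ) → binArr F a 0 n ≈ a 0
  binArr-zero-row a (+ zero)  = refl
  binArr-zero-row a (+ suc n) = refl
  binArr-zero-row a -[1+ n ]  = refl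

  y+[x-y]≈x : ∀ x y → y ⊕ (x ⊖ y) ≈ x
  y+[x-y]≈x x y = trans (+-comm y (x ⊖ y)) (//-rightDividesˡ y x)

  binArr-row-const : ∀ a {k} → k ≡ 0 → ∀ (n n′ : ℤ) → binArr F a k n ≈ binArr F a k n′
  binArr-row-const a ≡.refl n n′ = trans (binArr-zero-row a n) (sym (binArr-zero-row a n′))

  binArr-pascal : ∀ a k (n : ℤ) →
    binArr F a (suc k) (+ 1 + n) ≈ binArr F a k n ⊕ binArr F a (suc k) n
  binArr-pascal a k (+ n)        = refl
  -- In negative columns the recurrence is the definition of arrNeg, solved for the other entry.
  binArr-pascal a k -[1+ zero ]  = sym (y+[x-y]≈x _ _)
  binArr-pascal a k -[1+ suc n ] = sym (y+[x-y]≈x _ _)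

  sumTo-cong : ∀ m {f g} → (∀ i → i ≤ m → f i ≈ g i) → sumTo F m f ≈ sumTo F m g
  sumTo-cong zero    f≈g = f≈g 0 z≤n
  sumTo-cong (suc m) f≈g =
    +-cong (sumTo-cong m (λ i i≤m → f≈g i (m≤n⇒m≤1+n i≤m))) (f≈g (suc m) ≤-refl)

  sumTo-head : ∀ m f → sumTo F (suc m) f ≈ f 0 ⊕ sumTo F m (λ i → f (suc i))
  sumTo-head zero    f = refl
  sumTo-head (suc m) f = trans (+-congʳ (sumTo-head m f)) (+-assoc _ _ _)

  sumTo-distrib-+ : ∀ m f g →
    sumTo F m (λ i → f i ⊕ g i) ≈ sumTo F m f ⊕ sumTo F m g
  sumTo-distrib-+ zero    f g = refl
  sumTo-distrib-+ (suc m) f g =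
    trans (+-congʳ (sumTo-distrib-+ m f g)) (interchange _ _ _ _)

  suc-invariant⇒constant : ∀ (f : ℤ → Carrier) → (∀ n → f (+ 1 + n) ≈ f n) →
    ∀ n → f n ≈ f (+ 0)
  suc-invariant⇒constant f inv (+ zero)     = refl
  suc-invariant⇒constant f inv (+ suc n)    =
    trans (inv (+ n)) (suc-invariant⇒constant f inv (+ n))
  suc-invariant⇒constant f inv -[1+ zero ]  = sym (inv -[1+ 0 ])
  suc-invariant⇒constant f inv -[1+ suc n ] =
    trans (sym (inv -[1+ suc n ])) (suc-invariant⇒constant f inv -[1+ n ])

  module DiagonalSum (a b : ℕ → Carrier) where
    α β : ℕ → ℤ → Carrier
    α = binArr F a
    β = binArr F b

    term-cong : ∀ {i k n n′ p p′} → n ≡ n′ → p ≡ p′ → α i n * β k p ≈ α i n′ * β k p′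
    term-cong ≡.refl ≡.refl = refl

    diagonalSum : ℕ → ℤ → ℤ → Carrier
    diagonalSum m r s = sumTo F m (λ i → α i (r + + i) * β (m ∸ i) (s - + i))

    diagonalSum-cong : ∀ m {r r′ s s′} → r ≡ r′ → s ≡ s′ →
      diagonalSum m r s ≈ diagonalSum m r′ s′
    diagonalSum-cong m ≡.refl ≡.refl = refl

    diagonalSum-pascalˡ : ∀ m r s →
      diagonalSum (suc m) (r + + 1) s ≈ diagonalSum (suc m) r s ⊕ diagonalSum m (r + + 1) (s - + 1)
    diagonalSum-pascalˡ m r s = begin
      diagonalSum (suc m) (r + + 1) s
        ≈⟨ sumTo-head m _ ⟩
      α 0 (r + + 1 + + 0) * β (suc m) (s - + 0)
        ⊕ sumTo F m (λ j → α (suc j) (r + + 1 + + suc j) * β (m ∸ j) (s - + suc j))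
        ≈⟨ +-cong (*-congʳ (binArr-row-const a ≡.refl (r + + 1 + + 0) (r + + 0)))
                  (sumTo-cong m (λ j _ → split j)) ⟩
      α 0 (r + + 0) * β (suc m) (s - + 0) ⊕ sumTo F m (λ j → A j ⊕ B j)
        ≈⟨ +-congˡ (sumTo-distrib-+ m A B) ⟩
      α 0 (r + + 0) * β (suc m) (s - + 0) ⊕ (sumTo F m A ⊕ sumTo F m B)
        ≈⟨ +-assoc _ _ _ ⟨
      (α 0 (r + + 0) * β (suc m) (s - + 0) ⊕ sumTo F m A) ⊕ sumTo F m B
        ≈⟨ +-congʳ (sumTo-head m _) ⟨
      diagonalSum (suc m) r s ⊕ diagonalSum m (r + + 1) (s - + 1) ∎
      where
      A B : ℕ → Carrier
      A j = α (suc j) (r + + suc j) * β (m ∸ j) (s - + suc j)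
      B j = α j (r + + 1 + + j) * β (m ∸ j) (s - + 1 - + j)

      r+1+[1+j]≡1+[r+[1+j]] : ∀ (r j : ℤ) → r + + 1 + (+ 1 + j) ≡ + 1 + (r + (+ 1 + j))
      r+1+[1+j]≡1+[r+[1+j]] = solve-∀
      r+[1+j]≡r+1+j : ∀ (r j : ℤ) → r + (+ 1 + j) ≡ r + + 1 + j
      r+[1+j]≡r+1+j = solve-∀
      s-[1+j]≡s-1-j : ∀ (s j : ℤ) → s - (+ 1 + j) ≡ s - + 1 - j
      s-[1+j]≡s-1-j = solve-∀

      split : ∀ j → α (suc j) (r + + 1 + + suc j) * β (m ∸ j) (s - + suc j) ≈ A j ⊕ B j
      split j = begin
        α (suc j) (r + + 1 + + suc j) * β (m ∸ j) (s - + suc j)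
          ≈⟨ *-congʳ (reflexive (cong (α (suc j)) (r+1+[1+j]≡1+[r+[1+j]] r (+ j)))) ⟩
        α (suc j) (+ 1 + (r + + suc j)) * β (m ∸ j) (s - + suc j)
          ≈⟨ *-congʳ (binArr-pascal a j (r + + suc j)) ⟩
        (α j (r + + suc j) ⊕ α (suc j) (r + + suc j)) * β (m ∸ j) (s - + suc j)
          ≈⟨ distribʳ _ _ _ ⟩
        α j (r + + suc j) * β (m ∸ j) (s - + suc j) ⊕ A j
          ≈⟨ +-comm _ _ ⟩
        A j ⊕ α j (r + + suc j) * β (m ∸ j) (s - + suc j)
          ≈⟨ +-congˡ (term-cong (r+[1+j]≡r+1+j r (+ j)) (s-[1+j]≡s-1-j s (+ j))) ⟩
        A j ⊕ B j ∎

    diagonalSum-pascalʳ : ∀ m r s →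
      diagonalSum (suc m) r (s + + 1) ≈ diagonalSum (suc m) r s ⊕ diagonalSum m r s
    diagonalSum-pascalʳ m r s = begin
      sumTo F m (λ i → α i (r + + i) * β (suc m ∸ i) (s + + 1 - + i))
        ⊕ α (suc m) (r + + suc m) * β (m ∸ m) (s + + 1 - + suc m)
        ≈⟨ +-cong (sumTo-cong m split)
                  (*-congˡ (binArr-row-const b (n∸n≡0 m) (s + + 1 - + suc m) (s - + suc m))) ⟩
      sumTo F m (λ i → P i ⊕ Q i) ⊕ α (suc m) (r + + suc m) * β (m ∸ m) (s - + suc m)
        ≈⟨ +-congʳ (sumTo-distrib-+ m P Q) ⟩
      (sumTo F m P ⊕ sumTo F m Q) ⊕ α (suc m) (r + + suc m) * β (m ∸ m) (s - + suc m)
        ≈⟨ xy∙z≈xz∙y _ _ _ ⟩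
      diagonalSum (suc m) r s ⊕ diagonalSum m r s ∎
      where
      P Q : ℕ → Carrier
      P i = α i (r + + i) * β (suc m ∸ i) (s - + i)
      Q i = α i (r + + i) * β (m ∸ i) (s - + i)

      s+1-i≡1+[s-i] : ∀ (s i : ℤ) → s + + 1 - i ≡ + 1 + (s - i)
      s+1-i≡1+[s-i] = solve-∀

      split : ∀ i → i ≤ m → α i (r + + i) * β (suc m ∸ i) (s + + 1 - + i) ≈ P i ⊕ Q i
      split i i≤m = begin
        α i (r + + i) * β (suc m ∸ i) (s + + 1 - + i)
          ≈⟨ *-congˡ (reflexive (cong₂ β (+-∸-assoc 1 i≤m) (s+1-i≡1+[s-i] s (+ i)))) ⟩
        α i (r + + i) * β (suc (m ∸ i)) (+ 1 + (s - + i))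
          ≈⟨ *-congˡ (binArr-pascal b (m ∸ i) (s - + i)) ⟩
        α i (r + + i) * (β (m ∸ i) (s - + i) ⊕ β (suc (m ∸ i)) (s - + i))
          ≈⟨ distribˡ _ _ _ ⟩
        Q i ⊕ α i (r + + i) * β (suc (m ∸ i)) (s - + i)
          ≈⟨ +-comm _ _ ⟩
        α i (r + + i) * β (suc (m ∸ i)) (s - + i) ⊕ Q i
          ≈⟨ +-congʳ (*-congˡ (reflexive (cong (λ k → β k (s - + i)) (+-∸-assoc 1 i≤m)))) ⟨
        P i ⊕ Q i ∎

    diagonalSum-transfer : ∀ m r s → diagonalSum m (r + + 1) (s - + 1) ≈ diagonalSum m r s
    diagonalSum-transfer zero r s =
      *-cong (binArr-row-const a ≡.refl (r + + 1 + + 0) (r + + 0))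
             (binArr-row-const b ≡.refl (s - + 1 - + 0) (s - + 0))
    diagonalSum-transfer (suc m) r s = begin
      diagonalSum (suc m) (r + + 1) (s - + 1)
        ≈⟨ diagonalSum-pascalˡ m r (s - + 1) ⟩
      diagonalSum (suc m) r (s - + 1) ⊕ diagonalSum m (r + + 1) (s - + 1 - + 1)
        ≈⟨ +-congˡ (diagonalSum-transfer m r (s - + 1)) ⟩
      diagonalSum (suc m) r (s - + 1) ⊕ diagonalSum m r (s - + 1)
        ≈⟨ diagonalSum-pascalʳ m r (s - + 1) ⟨
      diagonalSum (suc m) r (s - + 1 + + 1)
        ≈⟨ diagonalSum-cong (suc m) {r} ≡.refl (s-1+1≡s s) ⟩
      diagonalSum (suc m) r s ∎
      where
      s-1+1≡s : ∀ (s : ℤ) → s - + 1 + + 1 ≡ s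
      s-1+1≡s = solve-∀

    diagonalSum-shift : ∀ m r s t → diagonalSum m (r + t) (s - t) ≈ diagonalSum m r s
    diagonalSum-shift m r s t = begin
      diagonalSum m (r + t) (s - t)     ≈⟨ suc-invariant⇒constant shifted step t ⟩
      diagonalSum m (r + + 0) (s - + 0) ≈⟨ diagonalSum-cong m (ℤ.+-identityʳ r) (ℤ.+-identityʳ s) ⟩
      diagonalSum m r s                 ∎
      where
      shifted : ℤ → Carrier
      shifted t = diagonalSum m (r + t) (s - t)

      r+[1+t]≡r+t+1 : ∀ (r t : ℤ) → r + (+ 1 + t) ≡ r + t + + 1
      r+[1+t]≡r+t+1 = solve-∀
      s-[1+t]≡s-t-1 : ∀ (s t : ℤ) → s - (+ 1 + t) ≡ s - t - + 1
      s-[1+t]≡s-t-1 = solve-∀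

      step : ∀ t → shifted (+ 1 + t) ≈ shifted t
      step t = trans (diagonalSum-cong m (r+[1+t]≡r+t+1 r t) (s-[1+t]≡s-t-1 s t))
                     (diagonalSum-transfer m (r + t) (s - t))

corollary5p9 : ∀ {c ℓ} (F : CommutativeRing c ℓ) → IsField F → CharZero F →
    (m : ℕ) (a b : ℕ → CommutativeRing.Carrier F) (r s t : ℤ) →
    CommutativeRing._≈_ F
      (sumTo F m (λ i → CommutativeRing._*_ F (binArr F a i (r + + i)) (binArr F b (m ∸ i) (s - + i))))
      (sumTo F m (λ i → CommutativeRing._*_ F (binArr F a i (r + + i + t)) (binArr F b (m ∸ i) (s - + i - t))))
corollary5p9 F _ _ m a b r s t = begin
  diagonalSum m r s              ≈⟨ diagonalSum-shift m r s t ⟨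
  diagonalSum m (r + t) (s - t)  ≈⟨ sumTo-cong F m (λ i _ →
                                      term-cong (r+t+i≡r+i+t r t (+ i)) (s-t-i≡s-i-t s t (+ i))) ⟩
  sumTo F m (λ i → binArr F a i (r + + i + t) * binArr F b (m ∸ i) (s - + i - t)) ∎
  where
  open CommutativeRing F using (_*_; setoid)
  open SetoidReasoning setoid
  open DiagonalSum F a b

  r+t+i≡r+i+t : ∀ (r t i : ℤ) → r + t + i ≡ r + i + t
  r+t+i≡r+i+t = solve-∀
  s-t-i≡s-i-t : ∀ (s t i : ℤ) → s - t - i ≡ s - i - t
  s-t-i≡s-i-t = solve-∀
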